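{- The functor $\mathcal{P}^{\omega}:\mathbf{Sets}\to\mathbf{Sets}$ preserves pullbacks along injective morphisms: if $A$ with projections $\pi_B:A\to B$, $\pi_C:A\to C$ is a pullback in $\mathbf{Sets}$ of $f_1:B\to D$ and $g_1:C\to D$ with $g_1$ injective, then $\mathcal{P}^{\omega}(A)$ with $\widehat{\pi_B},\widehat{\pi_C}$ is a pullback of $\widehat{f_1}$ and $\widehat{g_1}$.
   Context: For a set $M$ whose elements are regarded as atoms (urelements, not sets), let $\mathcal{P}^0(M)=M$, $\mathcal{P}^{i+1}(M)=\mathcal{P}(\mathcal{P}^i(M))$ and $\mathcal{P}^{\omega}(M)=\bigcup_{i\ge0}\mathcal{P}^i(M)$. For $f:M\to N$, $\widehat f=\mathcal{P}^{\omega}(f):\mathcal{P}^{\omega}(M)\to\mathcal{P}^{\omega}(N)$ is defined recursively by $\widehat f(x)=f(x)$ for $x\in M$ and $\widehat f(x)=\{\widehat f(x')\mid x'\in x\}$ otherwise. -}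

module Defs where

open import Level using (Level; Lift; _⊔_; Setω) renaming (zero to 0ℓ; suc to lsuc)
open import Data.Nat using (ℕ; zero; suc)
open import Data.Product using (Σ; _×_; _,_)
open import Data.Empty using (⊥)
open import Relation.Binary.PropositionalEquality using (_≡_)
open import Function.Definitions using (Injective)

lvl : ℕ → Level
lvl zero    = 0ℓ
lvl (suc i) = lsuc (lvl i)

-- 𝒫ⁱ(M): level 0 is the set of atoms M; level i+1 is the full power set
-- of 𝒫ⁱ(M), a subset being a predicate (characteristic family of types).
𝒫 : (i : ℕ) → Set → Set (lvl i)
𝒫 zero    M = M
𝒫 (suc i) M = 𝒫 i M → Set (lvl i)

-- Atoms are urelements: an atom never equals a set.  Since elements of different
-- levels may coincide (e.g. ∅ ∈ 𝒫¹ and ∅ ∈ 𝒫²), this is defined for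
-- arbitrary pairs of levels i, j.
Eq : {M : Set} (i j : ℕ) → 𝒫 i M → 𝒫 j M → Set (lvl i ⊔ lvl j)
Eq zero    zero    a b = a ≡ b
Eq zero    (suc j) a y = Lift _ ⊥
Eq (suc i) zero    x b = Lift _ ⊥
Eq {M} (suc i) (suc j) x y = Lift (lvl (suc i) ⊔ lvl (suc j))
  (((z : 𝒫 i M) → x z → Σ (𝒫 j M) λ w → y w × Eq i j z w)
 × ((w : 𝒫 j M) → y w → Σ (𝒫 i M) λ z → x z × Eq i j z w))

hat : {M N : Set} (f : M → N) (i : ℕ) → 𝒫 i M → 𝒫 i N
hat f zero    a = f a
hat {M} f (suc i) x = λ y → Σ (𝒫 i M) λ x' → x x' × Eq i i (hat f i x') y

record IsPullback {A B C D : Set} (f : B → D) (g : C → D)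
                  (πB : A → B) (πC : A → C) : Set where
  field
    commutes : ∀ a → f (πB a) ≡ g (πC a)
    exists   : ∀ b c → f b ≡ g c → Σ A λ a → πB a ≡ b × πC a ≡ c
    unique   : ∀ a a' → πB a ≡ πB a' → πC a ≡ πC a' → a ≡ a'

-- An element z ∈ 𝒫^ω(A) (at some level k) with π̂B(z) = x and π̂C(z) = y.
-- (A record, since the level k determines the universe of z.)
record Mediator {A B C : Set} (πB : A → B) (πC : A → C)
                (i j : ℕ) (x : 𝒫 i B) (y : 𝒫 j C) : Setω where
  field
    k   : ℕ
    z   : 𝒫 k A
    eqB : Eq k i (hat πB k z) x
    eqC : Eq k j (hat πC k z) y

-- (𝒫^ω(A), π̂B, π̂C) is a pullback of f̂ and ĝ in Sets, where 𝒫^ω(X) is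
-- ⋃ᵢ 𝒫ⁱ(X) with equality Eq (elements given as (level, element) pairs).
record IsPullbackω {A B C D : Set} (f : B → D) (g : C → D)
                   (πB : A → B) (πC : A → C) : Setω where
  field
    commutes : ∀ k (z : 𝒫 k A) →
      Eq k k (hat f k (hat πB k z)) (hat g k (hat πC k z))
    exists   : ∀ i j (x : 𝒫 i B) (y : 𝒫 j C) →
      Eq i j (hat f i x) (hat g j y) →
      Mediator πB πC i j x y
    unique   : ∀ k k' (z : 𝒫 k A) (z' : 𝒫 k' A) →
      Eq k k' (hat πB k z) (hat πB k' z') →
      Eq k k' (hat πC k z) (hat πC k' z') →
      Eq k k' z z'

module Submission where

-- For the theorem, commutativity of the square is functoriality.  In Sets the
-- pullback of an injection is an injection, so πB is injective and hence π̂B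
-- reflects Eq: this is uniqueness.  For existence, given x, y with f̂(x) = ĝ(y),
-- the mediating element is built by recursion on the level as the π̂B-preimage
-- of x; its image under π̂B is x because every element of x has a preimage
-- (recursively), and its image under π̂C is y because ĝ reflects Eq.

open import Defs
open import Relation.Binary.PropositionalEquality using (_≡_)
import Relation.Binary.PropositionalEquality as P
open import Function.Definitions using (Injective)
open import Function using (_∘_)
open import Level using (lift)
open import Data.Nat using (ℕ; zero; suc)
open import Data.Product using (Σ; _×_; _,_)

module _ {M : Set} where

  Eq-refl : ∀ i {x : 𝒫 i M} → Eq i i x x
  Eq-refl zero    = P.refl
  Eq-refl (suc i) = lift ((λ z xz → z , xz , Eq-refl i) , (λ w yw → w , yw , Eq-refl i))

  Eq-sym : ∀ i j {x : 𝒫 i M} {y : 𝒫 j M} → Eq i j x y → Eq j i y x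
  Eq-sym zero    zero    e              = P.sym e
  Eq-sym zero    (suc j) (lift ())
  Eq-sym (suc i) zero    (lift ())
  Eq-sym (suc i) (suc j) (lift (l , r)) =
    lift ( (λ w yw → let (z , xz , e) = r w yw in z , xz , Eq-sym i j e)
         , (λ z xz → let (w , yw , e) = l z xz in w , yw , Eq-sym i j e))

  Eq-trans : ∀ i j k {x : 𝒫 i M} {y : 𝒫 j M} {z : 𝒫 k M} →
             Eq i j x y → Eq j k y z → Eq i k x z
  Eq-trans zero    zero    zero    e₁ e₂ = P.trans e₁ e₂
  Eq-trans zero    zero    (suc k) e₁ (lift ())
  Eq-trans zero    (suc j) k       (lift ()) e₂
  Eq-trans (suc i) zero    k       (lift ()) e₂
  Eq-trans (suc i) (suc j) zero    e₁ (lift ())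
  Eq-trans (suc i) (suc j) (suc k) (lift (l₁ , r₁)) (lift (l₂ , r₂)) =
    lift ( (λ a xa → let (b , yb , e₁) = l₁ a xa ; (c , zc , e₂) = l₂ b yb
                     in c , zc , Eq-trans i j k e₁ e₂)
         , (λ c zc → let (b , yb , e₂) = r₂ c zc ; (a , xa , e₁) = r₁ b yb
                     in a , xa , Eq-trans i j k e₁ e₂))

module _ {M N : Set} (f : M → N) where

  ∈-hat : ∀ i {x : 𝒫 (suc i) M} {x' : 𝒫 i M} → x x' → hat f (suc i) x (hat f i x')
  ∈-hat i {x' = x'} xx' = x' , xx' , Eq-refl i

  hat-Eq-intro : ∀ i j (z : 𝒫 (suc i) M) (y : 𝒫 (suc j) N) →
    (∀ w → z w → Σ (𝒫 j N) λ y' → y y' × Eq i j (hat f i w) y') →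
    (∀ y' → y y' → Σ (𝒫 i M) λ w → z w × Eq i j (hat f i w) y') →
    Eq (suc i) (suc j) (hat f (suc i) z) y
  hat-Eq-intro i j z y match-z match-y =
    lift ( (λ u → λ { (w , zw , e) → let (y' , yy' , e') = match-z w zw
                                     in y' , yy' , Eq-trans i i j (Eq-sym i i e) e' })
         , (λ y' yy' → let (w , zw , e) = match-y y' yy'
                       in hat f i w , ∈-hat i zw , e))

module _ {M M' N : Set} (f : M → N) (g : M' → N) {i j : ℕ}
         {x : 𝒫 (suc i) M} {y : 𝒫 (suc j) M'}
         (e : Eq (suc i) (suc j) (hat f (suc i) x) (hat g (suc j) y)) where

  hat-Eq-elimˡ : ∀ x' → x x' → Σ (𝒫 j M') λ y' → y y' × Eq i j (hat f i x') (hat g j y')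
  hat-Eq-elimˡ x' xx' =
    let lift (l , _) = e ; (_ , (y' , yy' , e₁) , e₂) = l (hat f i x') (∈-hat f i xx')
    in y' , yy' , Eq-trans i j j e₂ (Eq-sym j j e₁)

  hat-Eq-elimʳ : ∀ y' → y y' → Σ (𝒫 i M) λ x' → x x' × Eq i j (hat f i x') (hat g j y')
  hat-Eq-elimʳ y' yy' =
    let lift (_ , r) = e ; (_ , (x' , xx' , e₁) , e₂) = r (hat g j y') (∈-hat g j yy')
    in x' , xx' , Eq-trans i i j e₁ e₂

module _ {M N : Set} (f : M → N) where

  hat-resp : ∀ i j {x : 𝒫 i M} {y : 𝒫 j M} → Eq i j x y → Eq i j (hat f i x) (hat f j y)
  hat-resp zero    zero    e         = P.cong f e
  hat-resp zero    (suc j) (lift ())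
  hat-resp (suc i) zero    (lift ())
  hat-resp (suc i) (suc j) {x} {y} (lift (l , r)) =
    hat-Eq-intro f i j x (hat f (suc j) y)
      (λ x' xx' → let (y' , yy' , e) = l x' xx'
                  in hat f j y' , ∈-hat f j yy' , hat-resp i j e)
      (λ { _ (y' , yy' , e₁) → let (x' , xx' , e₂) = r y' yy'
                               in x' , xx' , Eq-trans i j j (hat-resp i j e₂) e₁ })

  hat-reflects : Injective _≡_ _≡_ f →
    ∀ i j {x : 𝒫 i M} {y : 𝒫 j M} → Eq i j (hat f i x) (hat f j y) → Eq i j x y
  hat-reflects inj zero    zero    e         = inj e
  hat-reflects inj zero    (suc j) (lift ())
  hat-reflects inj (suc i) zero    (lift ())
  hat-reflects inj (suc i) (suc j) e =
    lift ( (λ x' xx' → let (y' , yy' , e') = hat-Eq-elimˡ f f e x' xx'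
                       in y' , yy' , hat-reflects inj i j e')
         , (λ y' yy' → let (x' , xx' , e') = hat-Eq-elimʳ f f e y' yy'
                       in x' , xx' , hat-reflects inj i j e'))

hat-∘ : {L M N : Set} (g : M → N) (f : L → M) →
        ∀ i {z : 𝒫 i L} → Eq i i (hat g i (hat f i z)) (hat (g ∘ f) i z)
hat-∘ g f zero    = P.refl
hat-∘ g f (suc i) {z} =
  hat-Eq-intro g i i (hat f (suc i) z) (hat (g ∘ f) (suc i) z)
    (λ { _ (z' , zz' , e) → hat (g ∘ f) i z' , ∈-hat (g ∘ f) i zz'
                          , Eq-trans i i i (hat-resp g i i (Eq-sym i i e)) (hat-∘ g f i) })
    (λ { _ (z' , zz' , e) → hat f i z' , ∈-hat f i zz' , Eq-trans i i i (hat-∘ g f i) e })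

hat-cong : {M N : Set} {f h : M → N} → (∀ a → f a ≡ h a) →
           ∀ i {z : 𝒫 i M} → Eq i i (hat f i z) (hat h i z)
hat-cong f≗h zero    {a} = f≗h a
hat-cong {f = f} {h} f≗h (suc i) {z} =
  hat-Eq-intro f i i z (hat h (suc i) z)
    (λ w zw → hat h i w , ∈-hat h i zw , hat-cong f≗h i)
    (λ { _ (w , zw , e) → w , zw , Eq-trans i i i (hat-cong f≗h i) e })

preimage : {M N : Set} (p : M → N) (i : ℕ) → 𝒫 (suc i) N → 𝒫 (suc i) M
preimage {N = N} p i x w = Σ (𝒫 i N) λ x' → x x' × Eq i i (hat p i w) x'

preimage-covers : {M N : Set} (p : M → N) (i : ℕ) (x : 𝒫 (suc i) N) →
  (∀ x' → x x' → Σ (𝒫 i M) λ w → Eq i i (hat p i w) x') →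
  Eq (suc i) (suc i) (hat p (suc i) (preimage p i x)) x
preimage-covers p i x cover =
  hat-Eq-intro p i i (preimage p i x) x
    (λ { _ (x' , xx' , e) → x' , xx' , e })
    (λ x' xx' → let (w , e) = cover x' xx' in w , (x' , xx' , e) , e)

pullback-injective : {A B C D : Set} {f : B → D} {g : C → D} {πB : A → B} {πC : A → C} →
  IsPullback f g πB πC → Injective _≡_ _≡_ g → Injective _≡_ _≡_ πB
pullback-injective {f = f} pb g-inj {a} {a'} e =
  unique a a' e (g-inj (P.trans (P.sym (commutes a)) (P.trans (P.cong f e) (commutes a'))))
  where open IsPullback pb

hat-commutes : {A B C D : Set} {f : B → D} {g : C → D} {πB : A → B} {πC : A → C} →
  (∀ a → f (πB a) ≡ g (πC a)) →
  ∀ k {z : 𝒫 k A} → Eq k k (hat f k (hat πB k z)) (hat g k (hat πC k z))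
hat-commutes {f = f} {g} {πB} {πC} comm k =
  Eq-trans k k k (hat-∘ f πB k)
    (Eq-trans k k k (hat-cong comm k) (Eq-sym k k (hat-∘ g πC k)))

module _ {A B C D : Set} {f : B → D} {g : C → D} {πB : A → B} {πC : A → C}
         (pb : IsPullback f g πB πC) (g-inj : Injective _≡_ _≡_ g) where
  open IsPullback pb

  mediate : ∀ i j (x : 𝒫 i B) (y : 𝒫 j C) → Eq i j (hat f i x) (hat g j y) →
            Σ (𝒫 i A) λ z → Eq i i (hat πB i z) x × Eq i j (hat πC i z) y
  mediate zero    zero    b c e = exists b c e
  mediate zero    (suc j) x y (lift ())
  mediate (suc i) zero    x y (lift ())
  mediate (suc i) (suc j) x y e = preimage πB i x , onto-x , onto-y
    where
    onto-x : Eq (suc i) (suc i) (hat πB (suc i) (preimage πB i x)) x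
    onto-x = preimage-covers πB i x λ x' xx' →
      let (y' , _ , e') = hat-Eq-elimˡ f g e x' xx' ; (w , ewB , _) = mediate i j x' y' e'
      in w , ewB

    -- For w in the preimage, ĝ(π̂C w) = f̂(π̂B w) = f̂(x') = ĝ(y'), and ĝ reflects Eq.
    onto-y : Eq (suc i) (suc j) (hat πC (suc i) (preimage πB i x)) y
    onto-y = hat-Eq-intro πC i j (preimage πB i x) y
      (λ { w (x' , xx' , ew) →
             let (y' , yy' , e') = hat-Eq-elimˡ f g e x' xx'
             in y' , yy' , hat-reflects g g-inj i j
                  (Eq-trans i i j (Eq-sym i i (hat-commutes commutes i))
                    (Eq-trans i i j (hat-resp f i i ew) e')) })
      (λ y' yy' → let (x' , xx' , e') = hat-Eq-elimʳ f g e y' yy'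
                      (w , ewB , ewC) = mediate i j x' y' e'
                  in w , (x' , xx' , ewB) , ewC)

lemma9 : {A B C D : Set} (f₁ : B → D) (g₁ : C → D) (πB : A → B) (πC : A → C) →
    IsPullback f₁ g₁ πB πC → Injective _≡_ _≡_ g₁ →
    IsPullbackω f₁ g₁ πB πC
lemma9 f₁ g₁ πB πC pb g₁-inj = record
  { commutes = λ k _ → hat-commutes (IsPullback.commutes pb) k
  ; exists   = λ i j x y e → let (z , eqB , eqC) = mediate pb g₁-inj i j x y e
                             in record { k = i ; z = z ; eqB = eqB ; eqC = eqC }
  ; unique   = λ k k' z z' eqB _ → hat-reflects πB (pullback-injective pb g₁-inj) k k' eqB
  }
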